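{- Let $(G,\lambda)$ be a temporal graph with undirected underlying graph $G$ and lifetime $\tau$, and let $s,t\in V(G)$ be non-adjacent. Let $(G',\lambda')$ be constructed as follows: for each temporal edge $(xy,i)$ of $(G,\lambda)$ (i.e. $xy\in E(G)$, $i\in\lambda(xy)$) add two new vertices $w^i_{(x,y)}$ and $w^i_{(y,x)}$; let $V(G')=V(G)\cup W$ where $W$ is the set of all these new vertices, and let $E(G')$ consist, for each temporal edge $(xy,i)$, of the edges $xw^i_{(x,y)}, xw^i_{(y,x)}, yw^i_{(x,y)}, yw^i_{(y,x)}$, with $\lambda'(xw^i_{(x,y)})=\lambda'(yw^i_{(y,x)})=\{2i\}$ and $\lambda'(xw^i_{(y,x)})=\lambda'(yw^i_{(x,y)})=\{2i+1\}$. Then for every integer $k$, $(G,\lambda)$ contains at least $k$ pairwise t-vertex disjoint strict temporal $s,t$-paths if and only if $(G',\lambda')$ contains at least $k$ pairwise t-vertex disjoint non-strict temporal $s,t$-paths; and for every integer $h$, $(G,\lambda)$ has a set of at most $h$ temporal vertices (not copies of $s$ or $t$) intersecting every strict temporal $s,t$-path if and only if $(G',\lambda')$ has a set of at most $h$ temporal vertices (not copies of $s$ or $t$) intersecting every non-strict temporal $s,t$-path.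
   Context: A temporal graph with lifetime $\tau$ is a pair $(G,\lambda)$ where $G$ is a finite simple graph and $\lambda$ assigns to each edge a subset of $[\tau]$; temporal vertices are elements of $V(G)\times[\tau]$. A temporal $s,t$-path is a sequence $(s=v_1,t_1,v_2,\dots,t_{p-1},v_p=t)$ of pairwise distinct vertices with $v_iv_{i+1}\in E(G)$ and $t_i\in\lambda(v_iv_{i+1})$; it is non-strict if $t_1\le\dots\le t_{p-1}$ and strict if $t_1<\dots<t_{p-1}$. Let $\gamma=0$ for non-strict and $\gamma=1$ for strict paths. The set $V^T(P)$ of temporal vertices contained in $P$ consists of $(s,t_1)$, $(t,t_{p-1}+\gamma)$, and for each $2\le i\le p-1$ all $(v_i,j)$ with $t_{i-1}+\gamma\le j\le t_i$. Two paths $P,Q$ of the same type are t-vertex disjoint if $V^T(P)\cap V^T(Q)\subseteq \{s,t\}\times\mathbb{N}$. A set of temporal vertices intersects a path $P$ if it intersects $V^T(P)$. -}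

module Defs where

open import Data.Nat using (ℕ; zero; suc; _+_; _*_; _≤_)
open import Data.Fin using (Fin; zero; suc; fromℕ; inject₁)
open import Data.Bool using (Bool; true; false)
open import Data.Product using (Σ; ∃; _×_; _,_)
open import Data.Sum using (_⊎_; inj₁; inj₂)
open import Data.Empty using (⊥)
open import Data.List using (List; length)
open import Data.List.Relation.Unary.All using (All)
open import Data.List.Relation.Unary.Any using (Any)
open import Relation.Binary.PropositionalEquality using (_≡_; _≢_)

record TStruct : Set₁ where
  field
    V    : Set
    life : ℕ
    E    : V → V → Set
    Lab  : V → V → ℕ → Set
open TStruct public

record TemporalGraph : Set where
  field
    n τ        : ℕ
    adj        : Fin n → Fin n → Bool
    adj-sym    : ∀ x y → adj x y ≡ adj y x
    adj-irrefl : ∀ x → adj x x ≡ false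
    lab        : Fin n → Fin n → ℕ → Bool
    lab-sym    : ∀ x y i → lab x y i ≡ lab y x i
    lab-edge   : ∀ x y i → lab x y i ≡ true → adj x y ≡ true
    lab-range  : ∀ x y i → lab x y i ≡ true → (1 ≤ i) × (i ≤ τ)
open TemporalGraph public

toStruct : TemporalGraph → TStruct
toStruct G = record
  { V = Fin (n G) ; life = τ G
  ; E = λ x y → adj G x y ≡ true
  ; Lab = λ x y i → lab G x y i ≡ true }

-- The new vertices: W contains w^i_(x,y) for every ordered pair (x,y)
-- with xy ∈ E(G) and i ∈ λ(xy).
W : TemporalGraph → Set
W G = Σ (Fin (n G) × Fin (n G) × ℕ) (λ { (x , y , i) → lab G x y i ≡ true })

wLab : (G : TemporalGraph) → Fin (n G) → W G → ℕ → Set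
wLab G v ((x , y , i) , _) j = (v ≡ x × j ≡ 2 * i) ⊎ (v ≡ y × j ≡ 2 * i + 1)

Lab' : (G : TemporalGraph) → Fin (n G) ⊎ W G → Fin (n G) ⊎ W G → ℕ → Set
Lab' G (inj₁ v) (inj₂ w) j = wLab G v w j
Lab' G (inj₂ w) (inj₁ v) j = wLab G v w j
Lab' G _ _ _ = ⊥

-- (G', λ') with V(G') = V(G) ∪ W, lifetime 2τ+1 (all labels are ≤ 2τ+1).
expand : TemporalGraph → TStruct
expand G = record
  { V = Fin (n G) ⊎ W G ; life = 2 * τ G + 1
  ; E = λ u v → ∃ λ j → Lab' G u v j
  ; Lab = Lab' G }

-- Temporal s,t-paths; γ = 0 non-strict, γ = 1 strict.
-- Vertices v_1..v_{m+2} (indices Fin (m+2)), times t_1..t_{m+1}.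
record TPath (T : TStruct) (γ : ℕ) (s t : V T) : Set where
  field
    m        : ℕ
    vert     : Fin (suc (suc m)) → V T
    time     : Fin (suc m) → ℕ
    distinct : ∀ a b → vert a ≡ vert b → a ≡ b
    start    : vert zero ≡ s
    end      : vert (fromℕ (suc m)) ≡ t
    edge     : ∀ i → E T (vert (inject₁ i)) (vert (suc i))
    label    : ∀ i → Lab T (vert (inject₁ i)) (vert (suc i)) (time i)
    mono     : ∀ (i : Fin m) → time (inject₁ i) + γ ≤ time (suc i)
open TPath public

_∈VT_ : ∀ {T γ s t} → V T × ℕ → TPath T γ s t → Set
_∈VT_ {T} {γ} (v , j) P =
    (v ≡ vert P zero × j ≡ time P zero)
  ⊎ (v ≡ vert P (fromℕ (suc (m P))) × j ≡ time P (fromℕ (m P)) + γ)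
  ⊎ Σ (Fin (m P)) (λ i → v ≡ vert P (suc (inject₁ i))
                        × (time P (inject₁ i) + γ ≤ j) × (j ≤ time P (suc i)))

TDisjoint : ∀ {T γ s t} → TPath T γ s t → TPath T γ s t → Set
TDisjoint {T} {γ} {s} {t} P Q =
  ∀ (v : V T) (j : ℕ) → (v , j) ∈VT P → (v , j) ∈VT Q → (v ≡ s) ⊎ (v ≡ t)

HasDisjointPaths : (T : TStruct) (γ : ℕ) (s t : V T) (k : ℕ) → Set
HasDisjointPaths T γ s t k =
  Σ (Fin k → TPath T γ s t) λ P → ∀ a b → a ≢ b → TDisjoint (P a) (P b)

HasCut : (T : TStruct) (γ : ℕ) (s t : V T) (h : ℕ) → Set
HasCut T γ s t h =
  Σ (List (V T × ℕ)) λ S →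
      (length S ≤ h)
    × All (λ { (v , j) → (v ≢ s) × (v ≢ t) × (1 ≤ j) × (j ≤ life T) }) S
    × (∀ (P : TPath T γ s t) → Any (λ x → x ∈VT P) S)

-- A strict s,t-path v₀ t₀ v₁ t₁ … v_{k+1} of G subdivides into the non-strict path
-- v₀ w^{t₀}_{(v₀,v₁)} v₁ w^{t₁}_{(v₁,v₂)} … of G′ with times 2t₀, 2t₀+1, 2t₁, 2t₁+1, ….
-- Conversely, G′ is bipartite between V(G) and the gadget vertices, so a non-strict s,t-path
-- of G′ alternates between the two sides, and monotonicity forces each gadget w^i_{(x,y)} to be
-- crossed from x at time 2i to y at time 2i+1; its V(G)-vertices form a strict path of G.
-- In both directions a fixed map π on temporal vertices sends the interior of the new path into
-- the interior of the old one: (v, j) ↦ (v, 2j) from G to G′, and (v, j) ↦ (v, ⌈j/2⌉),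
-- (w^i_{(x,y)}, j) ↦ (x, i) from G′ to G. Such a π carries t-vertex disjoint families along the
-- path translation and cuts against it, which gives all four implications.

module Submission where

open import Defs
open import Data.Nat using (ℕ; zero; suc; _+_; _*_; _≤_; _≤?_; z≤n; ⌈_/2⌉; ⌊_/2⌋)
open import Data.Nat.Properties as ℕ
  using (+-comm; +-identityʳ; ≤-refl; ≤-trans; ≤-reflexive; m≤m+n; m≤n+m; +-monoʳ-≤; +-monoˡ-≤;
         *-monoʳ-≤; *-monoʳ-<; *-cancelˡ-<; m+1+n≰m; ⌈n/2⌉-mono; n≡⌊n+n/2⌋; n≡⌈n+n/2⌉)
open import Data.Fin using (Fin; zero; suc; fromℕ; inject₁; _≟_)
open import Data.Fin.Properties using (suc-injective; inject₁-injective; fromℕ≢inject₁; 0≢1+n)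
open import Data.Bool using (true; false)
import Data.Bool.Properties as Bool
open import Data.Product using (Σ; ∃; _×_; _,_; proj₁; proj₂)
import Data.Product.Properties as Product
open import Data.Sum using (_⊎_; inj₁; inj₂; [_,_])
open import Data.Sum.Properties as Sum using (inj₁-injective; inj₂-injective)
open import Data.Empty using (⊥; ⊥-elim)
open import Data.List using (map; filter)
open import Data.List.Properties using (length-filter; length-map)
open import Data.List.Relation.Unary.All as All using ()
open import Data.List.Relation.Unary.All.Properties using (all-filter)
open import Data.List.Relation.Unary.Any using (Any)
open import Data.List.Membership.Propositional using (find; lose)
open import Data.List.Membership.Propositional.Properties using (∈-map⁺; ∈-filter⁺)
open import Function using (_∘_; Injective)
open import Function.Bundles using (_⇔_; mk⇔)
open import Relation.Nullary using (yes; no; ¬?; _×-dec_)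
open import Relation.Unary using (Decidable)
open import Relation.Binary.Definitions using (DecidableEquality)
open import Relation.Binary.PropositionalEquality hiding ([_])
open import Axiom.UniquenessOfIdentityProofs using (module Decidable⇒UIP)

double : ℕ → ℕ
double zero    = zero
double (suc n) = suc (suc (double n))

even : ∀ {k} → Fin (suc k) → Fin (suc (double k))
even zero             = zero
even {suc k} (suc i)  = suc (suc (even i))

odd : ∀ {k} → Fin k → Fin (suc (double k))
odd {suc k} zero    = suc zero
odd {suc k} (suc i) = suc (suc (odd i))

data Parity {k} : Fin (suc (double k)) → Set where
  at-even : ∀ i → Parity (even i)
  at-odd  : ∀ i → Parity (odd i)

parity : ∀ {k} (a : Fin (suc (double k))) → Parity a
parity zero = at-even zero
parity {suc k} (suc zero) = at-odd zero
parity {suc k} (suc (suc a)) with parity a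
... | at-even i = at-even (suc i)
... | at-odd i  = at-odd (suc i)

even-injective : ∀ {k} {i j : Fin (suc k)} → even i ≡ even j → i ≡ j
even-injective {i = zero}  {zero}  _ = refl
even-injective {suc k} {zero}  {suc j} ()
even-injective {suc k} {suc i} {zero}  ()
even-injective {suc k} {suc i} {suc j} p = cong suc (even-injective (suc-injective (suc-injective p)))

even-inject₁ : ∀ {k} (i : Fin (suc k)) → even {suc k} (inject₁ i) ≡ inject₁ (inject₁ (even i))
even-inject₁ zero = refl
even-inject₁ {suc k} (suc i) = cong (λ a → suc (suc a)) (even-inject₁ i)

odd≡suc-even : ∀ {k} (i : Fin (suc k)) → odd {suc k} i ≡ suc (inject₁ (even i))
odd≡suc-even zero = refl
odd≡suc-even {suc k} (suc i) = cong (λ a → suc (suc a)) (odd≡suc-even i)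

inject₁-odd : ∀ {k} (i : Fin k) → inject₁ (odd i) ≡ suc (even (inject₁ i))
inject₁-odd {suc k} zero = refl
inject₁-odd {suc k} (suc i) = cong (λ a → suc (suc a)) (inject₁-odd i)

suc-odd : ∀ {k} (i : Fin k) → suc (odd i) ≡ inject₁ (even (suc i))
suc-odd {suc k} zero = refl
suc-odd {suc k} (suc i) = cong (λ a → suc (suc a)) (suc-odd i)

fromℕ-double : ∀ k → fromℕ (double k) ≡ even (fromℕ k)
fromℕ-double zero = refl
fromℕ-double (suc k) = cong (λ a → suc (suc a)) (fromℕ-double k)

module _ {A : Set} where

  interleave : ∀ {k} → (Fin (suc k) → A) → (Fin k → A) → Fin (suc (double k)) → A
  interleave e o zero = e zero
  interleave {suc k} e o (suc zero) = o zero
  interleave {suc k} e o (suc (suc a)) = interleave (e ∘ suc) (o ∘ suc) a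

  interleave-even : ∀ {k} e o (i : Fin (suc k)) → interleave e o (even i) ≡ e i
  interleave-even e o zero = refl
  interleave-even {suc k} e o (suc i) = interleave-even (e ∘ suc) (o ∘ suc) i

  interleave-odd : ∀ {k} e o (i : Fin k) → interleave e o (odd i) ≡ o i
  interleave-odd {suc k} e o zero = refl
  interleave-odd {suc k} e o (suc i) = interleave-odd (e ∘ suc) (o ∘ suc) i

  interleave-injective : ∀ {k} {e : Fin (suc k) → A} {o : Fin k → A} →
    Injective _≡_ _≡_ e → Injective _≡_ _≡_ o → (∀ i j → e i ≢ o j) →
    Injective _≡_ _≡_ (interleave e o)
  interleave-injective {e = e} {o} e-inj o-inj e≢o {a} {b} eq with parity a | parity b
  ... | at-even i | at-even j =
    cong even (e-inj (subst₂ _≡_ (interleave-even e o i) (interleave-even e o j) eq))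
  ... | at-even i | at-odd j  =
    ⊥-elim (e≢o i j (subst₂ _≡_ (interleave-even e o i) (interleave-odd e o j) eq))
  ... | at-odd i  | at-even j =
    ⊥-elim (e≢o j i (subst₂ _≡_ (interleave-even e o j) (interleave-odd e o i) (sym eq)))
  ... | at-odd i  | at-odd j  =
    cong odd (o-inj (subst₂ _≡_ (interleave-odd e o i) (interleave-odd e o j) eq))

module _ {B : Set} where

  alternate : ∀ {k} → (Fin k → B) → (Fin k → B) → Fin (double k) → B
  alternate {suc k} f g zero = f zero
  alternate {suc k} f g (suc zero) = g zero
  alternate {suc k} f g (suc (suc b)) = alternate (f ∘ suc) (g ∘ suc) b

  alternate-steps : ∀ {k} (R : B → B → Set) (f g : Fin (suc k) → B) →
    (∀ i → R (f i) (g i)) → (∀ i → R (g (inject₁ i)) (f (suc i))) →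
    ∀ a → R (alternate f g (inject₁ a)) (alternate f g (suc a))
  alternate-steps R f g fg gf zero = fg zero
  alternate-steps {suc k} R f g fg gf (suc zero) = gf zero
  alternate-steps {suc k} R f g fg gf (suc (suc a)) =
    alternate-steps R (f ∘ suc) (g ∘ suc) (fg ∘ suc) (gf ∘ suc) a

module _ {A B : Set} where

  interleave-steps : ∀ {k} (R : A → A → B → Set)
    (e : Fin (suc (suc k)) → A) (o : Fin (suc k) → A) (f g : Fin (suc k) → B) →
    (∀ i → R (e (inject₁ i)) (o i) (f i)) → (∀ i → R (o i) (e (suc i)) (g i)) →
    ∀ b → R (interleave e o (inject₁ b)) (interleave e o (suc b)) (alternate f g b)
  interleave-steps R e o f g eo oe zero = eo zero
  interleave-steps R e o f g eo oe (suc zero) = oe zero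
  interleave-steps {suc k} R e o f g eo oe (suc (suc b)) =
    interleave-steps R (e ∘ suc) (o ∘ suc) (f ∘ suc) (g ∘ suc) (eo ∘ suc) (oe ∘ suc) b

  interleave-windows : ∀ {k} (Q : A → B → B → Set)
    (e : Fin (suc (suc k)) → A) (o : Fin (suc k) → A) (f g : Fin (suc k) → B) →
    (∀ i → Q (o i) (f i) (g i)) → (∀ i → Q (e (suc (inject₁ i))) (g (inject₁ i)) (f (suc i))) →
    ∀ a → Q (interleave e o (suc (inject₁ a))) (alternate f g (inject₁ a)) (alternate f g (suc a))
  interleave-windows Q e o f g at-o at-e zero = at-o zero
  interleave-windows {suc k} Q e o f g at-o at-e (suc zero) = at-e zero
  interleave-windows {suc k} Q e o f g at-o at-e (suc (suc a)) =
    interleave-windows Q (e ∘ suc) (o ∘ suc) (f ∘ suc) (g ∘ suc) (at-o ∘ suc) (at-e ∘ suc) a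

inject₁≢suc : ∀ {k} (i : Fin k) → inject₁ i ≢ suc i
inject₁≢suc zero    ()
inject₁≢suc (suc i) = inject₁≢suc i ∘ suc-injective

inject₁-or-last : ∀ {k} (i : Fin (suc k)) → (∃ λ c → i ≡ inject₁ c) ⊎ i ≡ fromℕ k
inject₁-or-last {zero}  zero    = inj₂ refl
inject₁-or-last {suc k} zero    = inj₁ (zero , refl)
inject₁-or-last {suc k} (suc i) with inject₁-or-last i
... | inj₁ (c , i≡c) = inj₁ (suc c , cong suc i≡c)
... | inj₂ i≡last    = inj₂ (cong suc i≡last)

module _ {X Y : Set} where

  IsInj₁ IsInj₂ : X ⊎ Y → Set
  IsInj₁ z = ∃ λ x → z ≡ inj₁ x
  IsInj₂ z = ∃ λ y → z ≡ inj₂ y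

  Crosses : X ⊎ Y → X ⊎ Y → Set
  Crosses z z′ = (IsInj₁ z → IsInj₂ z′) × (IsInj₂ z → IsInj₁ z′)

  Alternating : ∀ {n} → (Fin (suc n) → X ⊎ Y) → Set
  Alternating u = ∀ i → Crosses (u (inject₁ i)) (u (suc i))

  private
    ¬inj₁∧inj₂ : ∀ {z} → IsInj₁ z → IsInj₂ z → ⊥
    ¬inj₁∧inj₂ (_ , refl) (_ , ())

    shift₂ : ∀ {n} (u : Fin (suc (suc (suc n))) → X ⊎ Y) →
      Alternating u → Alternating (λ a → u (suc (suc a)))
    shift₂ u alt i = alt (suc (suc i))

    two-steps : ∀ {n} (u : Fin (suc (suc (suc n))) → X ⊎ Y) →
      Alternating u → IsInj₁ (u zero) → IsInj₁ (u (suc (suc zero)))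
    two-steps u alt first = proj₂ (alt (suc zero)) (proj₁ (alt zero) first)

  alternating-odd-length : ∀ {M} (u : Fin (suc (suc M)) → X ⊎ Y) → Alternating u →
    IsInj₁ (u zero) → IsInj₁ (u (fromℕ (suc M))) → ∃ λ k → M ≡ suc (double k)
  alternating-odd-length {zero} u alt first last = ⊥-elim (¬inj₁∧inj₂ last (proj₁ (alt zero) first))
  alternating-odd-length {suc zero} u alt first last = zero , refl
  alternating-odd-length {suc (suc M)} u alt first last
    with alternating-odd-length (λ a → u (suc (suc a))) (shift₂ u alt) (two-steps u alt first) last
  ... | k , refl = suc k , refl

  alternating-even : ∀ {k} (u : Fin (suc (double k)) → X ⊎ Y) → Alternating u →
    IsInj₁ (u zero) → ∀ i → IsInj₁ (u (even i))
  alternating-even u alt first zero = first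
  alternating-even {suc k} u alt first (suc i) =
    alternating-even (λ a → u (suc (suc a))) (shift₂ u alt) (two-steps u alt first) i

  alternating-odd : ∀ {k} (u : Fin (suc (double k)) → X ⊎ Y) → Alternating u →
    IsInj₁ (u zero) → ∀ i → IsInj₂ (u (odd i))
  alternating-odd {suc k} u alt first zero = proj₁ (alt zero) first
  alternating-odd {suc k} u alt first (suc i) =
    alternating-odd (λ a → u (suc (suc a))) (shift₂ u alt) (two-steps u alt first) i

2*n≡n+n : ∀ n → 2 * n ≡ n + n
2*n≡n+n n = cong (n +_) (+-identityʳ n)

+1≡suc : ∀ n → n + 1 ≡ suc n
+1≡suc n = +-comm n 1

m+1≤n⇒2m+1≤2n : ∀ {m n} → m + 1 ≤ n → 2 * m + 1 ≤ 2 * n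
m+1≤n⇒2m+1≤2n {m} {n} p =
  subst (_≤ 2 * n) (sym (+1≡suc (2 * m))) (*-monoʳ-< 2 (subst (_≤ n) (+1≡suc m) p))

2m+1≤2n⇒m+1≤n : ∀ {m n} → 2 * m + 1 ≤ 2 * n → m + 1 ≤ n
2m+1≤2n⇒m+1≤n {m} {n} p =
  subst (_≤ n) (sym (+1≡suc m)) (*-cancelˡ-< 2 m n (subst (_≤ 2 * n) (+1≡suc (2 * m)) p))

⌈2n+1/2⌉≡n+1 : ∀ n → ⌈ 2 * n + 1 /2⌉ ≡ n + 1
⌈2n+1/2⌉≡n+1 n = begin
  ⌈ 2 * n + 1 /2⌉   ≡⟨ cong ⌈_/2⌉ (+1≡suc (2 * n)) ⟩
  suc ⌊ 2 * n /2⌋   ≡⟨ cong (suc ∘ ⌊_/2⌋) (2*n≡n+n n) ⟩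
  suc ⌊ n + n /2⌋   ≡⟨ cong suc (sym (n≡⌊n+n/2⌋ n)) ⟩
  suc n             ≡⟨ sym (+1≡suc n) ⟩
  n + 1             ∎
  where open ≡-Reasoning

⌈2n/2⌉≡n : ∀ n → ⌈ 2 * n /2⌉ ≡ n
⌈2n/2⌉≡n n = trans (cong ⌈_/2⌉ (2*n≡n+n n)) (sym (n≡⌈n+n/2⌉ n))

2m+1≤n⇒m+1≤⌈n/2⌉ : ∀ {m n} → 2 * m + 1 ≤ n → m + 1 ≤ ⌈ n /2⌉
2m+1≤n⇒m+1≤⌈n/2⌉ {m} p = subst (_≤ _) (⌈2n+1/2⌉≡n+1 m) (⌈n/2⌉-mono p)

n≤2m⇒⌈n/2⌉≤m : ∀ {m n} → n ≤ 2 * m → ⌈ n /2⌉ ≤ m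
n≤2m⇒⌈n/2⌉≤m {m} p = subst (_ ≤_) (⌈2n/2⌉≡n m) (⌈n/2⌉-mono p)

≤⇒+0≤ : ∀ {m n} → m ≤ n → m + 0 ≤ n
≤⇒+0≤ {m} = subst (_≤ _) (sym (+-identityʳ m))

+0≤⇒≤ : ∀ {m n} → m + 0 ≤ n → m ≤ n
+0≤⇒≤ {m} = subst (_≤ _) (+-identityʳ m)

module _ {T : TStruct} {γ : ℕ} {s t : V T} where

  Interior : TPath T γ s t → V T × ℕ → Set
  Interior P (v , j) = Σ (Fin (m P)) λ i →
    v ≡ vert P (suc (inject₁ i)) × time P (inject₁ i) + γ ≤ j × j ≤ time P (suc i)

  endpoint-or-interior : (P : TPath T γ s t) {v : V T} {j : ℕ} →
    (v , j) ∈VT P → (v ≡ s ⊎ v ≡ t) ⊎ Interior P (v , j)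
  endpoint-or-interior P (inj₁ (v≡ , _))        = inj₁ (inj₁ (trans v≡ (start P)))
  endpoint-or-interior P (inj₂ (inj₁ (v≡ , _))) = inj₁ (inj₂ (trans v≡ (end P)))
  endpoint-or-interior P (inj₂ (inj₂ int))      = inj₂ int

  interior-not-endpoint : (P : TPath T γ s t) {v : V T} {j : ℕ} →
    Interior P (v , j) → v ≢ s × v ≢ t
  interior-not-endpoint P (i , refl , _) =
      (λ v≡s → 0≢1+n (sym (distinct P _ _ (trans v≡s (sym (start P))))))
    , (λ v≡t → fromℕ≢inject₁ (sym (suc-injective (distinct P _ _ (trans v≡t (sym (end P)))))))

Admissible : (T : TStruct) → V T → V T → V T × ℕ → Set
Admissible T s t (v , j) = v ≢ s × v ≢ t × 1 ≤ j × j ≤ life T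

LabelledWithinLifetime : TStruct → Set
LabelledWithinLifetime T = ∀ {u v j} → Lab T u v j → 1 ≤ j × j ≤ life T

interior-admissible : ∀ {T γ s t} → LabelledWithinLifetime T → (P : TPath T γ s t) →
  ∀ {x} → Interior P x → Admissible T s t x
interior-admissible {γ = γ} within P {v , j} int@(i , _ , lo , hi) =
    proj₁ (interior-not-endpoint P int)
  , proj₂ (interior-not-endpoint P int)
  , ≤-trans (proj₁ (within (label P (inject₁ i)))) (≤-trans (m≤m+n _ γ) lo)
  , ≤-trans hi (proj₂ (within (label P (suc i))))

module Transfer {T₁ T₂ : TStruct} {γ₁ γ₂ : ℕ} {s₁ t₁ : V T₁} {s₂ t₂ : V T₂}
  (π : V T₂ × ℕ → V T₁ × ℕ)
  (lift : (P : TPath T₁ γ₁ s₁ t₁) →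
          Σ (TPath T₂ γ₂ s₂ t₂) λ Q → ∀ {x} → Interior Q x → Interior P (π x)) where

  private
    Φ : TPath T₁ γ₁ s₁ t₁ → TPath T₂ γ₂ s₂ t₂
    Φ = proj₁ ∘ lift

    reflects : ∀ P {x} → Interior (Φ P) x → Interior P (π x)
    reflects P = proj₂ (lift P)

  disjoint-transfer : ∀ {k} → HasDisjointPaths T₁ γ₁ s₁ t₁ k → HasDisjointPaths T₂ γ₂ s₂ t₂ k
  disjoint-transfer (P , disjoint) = Φ ∘ P , disjoint′
    where
    disjoint′ : ∀ a b → a ≢ b → TDisjoint (Φ (P a)) (Φ (P b))
    disjoint′ a b a≢b v j v∈a v∈b
      with endpoint-or-interior (Φ (P a)) v∈a | endpoint-or-interior (Φ (P b)) v∈b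
    ... | inj₁ v-end | _          = v-end
    ... | inj₂ _     | inj₁ v-end = v-end
    ... | inj₂ int-a | inj₂ int-b = ⊥-elim ([ proj₁ inner , proj₂ inner ]
      (disjoint a b a≢b _ _ (inj₂ (inj₂ (reflects (P a) int-a))) (inj₂ (inj₂ (reflects (P b) int-b)))))
      where inner = interior-not-endpoint (P a) (reflects (P a) int-a)

  cut-transfer : DecidableEquality (V T₁) → LabelledWithinLifetime T₁ →
    ∀ {h} → HasCut T₂ γ₂ s₂ t₂ h → HasCut T₁ γ₁ s₁ t₁ h
  cut-transfer _≟_ within (S , |S|≤h , admissible , hits) =
      S′
    , ≤-trans (length-filter admissible? (map π S))
              (≤-trans (≤-reflexive (length-map π S)) |S|≤h)
    , All.map (λ { {_ , _} adm → adm }) (all-filter admissible? (map π S))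
    , hits′
    where
    admissible? : Decidable (Admissible T₁ s₁ t₁)
    admissible? (v , j) = ¬? (v ≟ s₁) ×-dec ¬? (v ≟ t₁) ×-dec 1 ≤? j ×-dec j ≤? life T₁
    -- π may leave V × [life] or hit s, t; such points are never interior, so they can go.
    S′ = filter admissible? (map π S)
    hits′ : ∀ P → Any (_∈VT P) S′
    hits′ P with find (hits (Φ P))
    ... | x , x∈S , x∈ΦP with endpoint-or-interior (Φ P) x∈ΦP | All.lookup admissible x∈S
    ... | inj₁ x-end | x≢s , x≢t , _ = ⊥-elim ([ x≢s , x≢t ] x-end)
    ... | inj₂ int   | _ =
      lose (∈-filter⁺ admissible? (∈-map⁺ π x∈S) (interior-admissible within P int′)) (inj₂ (inj₂ int′))
      where int′ = reflects P int

module _ (G : TemporalGraph) where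

  w-from w-to : W G → Fin (n G)
  w-from ((x , _ , _) , _) = x
  w-to   ((_ , y , _) , _) = y

  w-time : W G → ℕ
  w-time ((_ , _ , i) , _) = i

  traverse-gadget : ∀ (w : W G) {u u′ a b} → u ≢ u′ → a ≤ b → wLab G u w a → wLab G u′ w b →
    u ≡ w-from w × u′ ≡ w-to w × a ≡ 2 * w-time w × b ≡ 2 * w-time w + 1
  traverse-gadget w u≢u′ a≤b (inj₁ (refl , a≡)) (inj₂ (refl , b≡)) = refl , refl , a≡ , b≡
  traverse-gadget w u≢u′ a≤b (inj₁ (refl , _)) (inj₁ (refl , _)) = ⊥-elim (u≢u′ refl)
  traverse-gadget w u≢u′ a≤b (inj₂ (refl , _)) (inj₂ (refl , _)) = ⊥-elim (u≢u′ refl)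
  traverse-gadget w u≢u′ a≤b (inj₂ (refl , refl)) (inj₁ (refl , refl)) = ⊥-elim (m+1+n≰m _ a≤b)

  lab′-crosses : ∀ {z z′ j} → Lab' G z z′ j → Crosses z z′
  lab′-crosses {inj₁ _} {inj₂ w} _ = (λ _ → w , refl) , λ { (_ , ()) }
  lab′-crosses {inj₂ _} {inj₁ v} _ = (λ { (_ , ()) }) , λ _ → v , refl

  gadget-within-lifetime : ∀ {v j} (w : W G) → wLab G v w j → 1 ≤ j × j ≤ 2 * τ G + 1
  gadget-within-lifetime ((x , y , i) , p) (inj₁ (_ , refl)) =
      ≤-trans (proj₁ (lab-range G x y i p)) (m≤m+n i _)
    , ≤-trans (*-monoʳ-≤ 2 (proj₂ (lab-range G x y i p))) (m≤m+n _ 1)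
  gadget-within-lifetime ((x , y , i) , p) (inj₂ (_ , refl)) =
      m≤n+m 1 (2 * i)
    , +-monoˡ-≤ 1 (*-monoʳ-≤ 2 (proj₂ (lab-range G x y i p)))

  toStruct-within-lifetime : LabelledWithinLifetime (toStruct G)
  toStruct-within-lifetime = lab-range G _ _ _

  expand-within-lifetime : LabelledWithinLifetime (expand G)
  expand-within-lifetime {inj₁ _} {inj₂ w} = gadget-within-lifetime w
  expand-within-lifetime {inj₂ w} {inj₁ _} = gadget-within-lifetime w

  _≟ᵉ_ : DecidableEquality (V (expand G))
  _≟ᵉ_ = Sum.≡-dec _≟_ (Product.≡-dec (Product.≡-dec _≟_ (Product.≡-dec _≟_ ℕ._≟_))
                                      λ p q → yes (Decidable⇒UIP.≡-irrelevant Bool._≟_ p q))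

module Correspondence (G : TemporalGraph) (s t : Fin (n G)) (s≁t : adj G s t ≡ false) where

  StrictPath NonStrictPath : Set
  StrictPath    = TPath (toStruct G) 1 s t
  NonStrictPath = TPath (expand G) 0 (inj₁ s) (inj₁ t)

  project : V (expand G) × ℕ → Fin (n G) × ℕ
  project (inj₁ v , j) = v , ⌈ j /2⌉
  -- (x, i) is interior unless x = s; then y ≠ t as s and t are not adjacent, so (y, i+1) is.
  project (inj₂ ((x , y , i) , _) , _) with x ≟ s
  ... | yes _ = y , i + 1
  ... | no _  = x , i

  embed : Fin (n G) × ℕ → V (expand G) × ℕ
  embed (v , j) = inj₁ v , 2 * j

  module Subdivide (P : StrictPath) where

    arc : Fin (suc (m P)) → W G
    arc i = (vert P (inject₁ i) , vert P (suc i) , time P i) , label P i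

    double-time double-time+1 : Fin (suc (m P)) → ℕ
    double-time i   = 2 * time P i
    double-time+1 i = 2 * time P i + 1

    vert′ : Fin (suc (double (suc (m P)))) → V (expand G)
    vert′ = interleave (inj₁ ∘ vert P) (inj₂ ∘ arc)

    time′ : Fin (double (suc (m P))) → ℕ
    time′ = alternate double-time double-time+1

    label′ : ∀ b → Lab' G (vert′ (inject₁ b)) (vert′ (suc b)) (time′ b)
    label′ = interleave-steps (Lab' G) (inj₁ ∘ vert P) (inj₂ ∘ arc) double-time double-time+1
      (λ _ → inj₁ (refl , refl)) (λ _ → inj₂ (refl , refl))

    mono′ : ∀ a → time′ (inject₁ a) + 0 ≤ time′ (suc a)
    mono′ = alternate-steps (λ lo hi → lo + 0 ≤ hi) double-time double-time+1
      (λ i → +-monoʳ-≤ (2 * time P i) z≤n) (λ i → ≤⇒+0≤ (m+1≤n⇒2m+1≤2n (mono P i)))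

    arc-injective : ∀ {i j} → arc i ≡ arc j → i ≡ j
    arc-injective eq = inject₁-injective (distinct P _ _ (cong (w-from G) eq))

    path : NonStrictPath
    path = record
      { m        = suc (double (m P))
      ; vert     = vert′
      ; time     = time′
      ; distinct = λ _ _ → interleave-injective {e = inj₁ ∘ vert P} {o = inj₂ ∘ arc}
                       (distinct P _ _ ∘ inj₁-injective) (arc-injective ∘ inj₂-injective) λ _ _ ()
      ; start    = cong inj₁ (start P)
      ; end      = begin
          vert′ (fromℕ (double (suc (m P))))  ≡⟨ cong vert′ (fromℕ-double (suc (m P))) ⟩
          vert′ (even (fromℕ (suc (m P))))   ≡⟨ interleave-even (inj₁ ∘ vert P) (inj₂ ∘ arc) _ ⟩
          inj₁ (vert P (fromℕ (suc (m P))))  ≡⟨ cong inj₁ (end P) ⟩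
          inj₁ t                             ∎
      ; edge     = λ b → time′ b , label′ b
      ; label    = label′
      ; mono     = mono′
      }
      where open ≡-Reasoning

    arc-interior : ∀ i {j} → Interior P (project (inj₂ (arc i) , j))
    arc-interior i with vert P (inject₁ i) ≟ s
    arc-interior zero    | no x≢s = ⊥-elim (x≢s (start P))
    arc-interior (suc c) | no _   = c , refl , mono P c , ≤-refl
    arc-interior i | yes x≡s with inject₁-or-last i
    ... | inj₁ (c , refl) = c , refl , ≤-refl , mono P c
    ... | inj₂ refl = ⊥-elim (true≢false (trans (sym s~t) s≁t))
      where
      s~t : adj G s t ≡ true
      s~t = lab-edge G s t _ (subst₂ (λ x y → lab G x y _ ≡ true) x≡s (end P) (label P _))
      true≢false : true ≢ false
      true≢false ()

    reflects : ∀ {x} → Interior path x → Interior P (project x)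
    reflects {u , j} (a , refl , lo , hi) =
      interleave-windows (λ u lo hi → lo + 0 ≤ j → j ≤ hi → Interior P (project (u , j)))
        (inj₁ ∘ vert P) (inj₂ ∘ arc) double-time double-time+1
        (λ i _ _ → arc-interior i {j})
        (λ i lo hi → i , refl , 2m+1≤n⇒m+1≤⌈n/2⌉ (+0≤⇒≤ lo) , n≤2m⇒⌈n/2⌉≤m hi)
        a lo hi

  -- The fields of a non-strict path of G′ of length m = 2k+1, passed separately so that the
  -- oddness of the length holds definitionally.
  module Contract (k : ℕ)
    (u : Fin (suc (double (suc k))) → V (expand G)) (τ′ : Fin (double (suc k)) → ℕ)
    (u-distinct : ∀ a b → u a ≡ u b → a ≡ b)
    (u-start : u zero ≡ inj₁ s) (u-end : u (fromℕ (double (suc k))) ≡ inj₁ t)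
    (u-label : ∀ b → Lab' G (u (inject₁ b)) (u (suc b)) (τ′ b))
    (τ′-mono : ∀ a → τ′ (inject₁ a) + 0 ≤ τ′ (suc a)) where

    u-alternating : Alternating u
    u-alternating b = lab′-crosses G (u-label b)

    vertex : Fin (suc (suc k)) → Fin (n G)
    vertex i = proj₁ (alternating-even u u-alternating (s , u-start) i)

    u-even : ∀ i → u (even i) ≡ inj₁ (vertex i)
    u-even i = proj₂ (alternating-even u u-alternating (s , u-start) i)

    gadget : Fin (suc k) → W G
    gadget i = proj₁ (alternating-odd u u-alternating (s , u-start) i)

    u-odd : ∀ i → u (odd i) ≡ inj₂ (gadget i)
    u-odd i = proj₂ (alternating-odd u u-alternating (s , u-start) i)

    stamp : Fin (suc k) → ℕ
    stamp i = w-time G (gadget i)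

    vertex-injective : ∀ {i j} → vertex i ≡ vertex j → i ≡ j
    vertex-injective {i} {j} eq =
      even-injective (u-distinct _ _ (trans (u-even i) (trans (cong inj₁ eq) (sym (u-even j)))))

    traversal : ∀ i → vertex (inject₁ i) ≡ w-from G (gadget i) × vertex (suc i) ≡ w-to G (gadget i)
                    × τ′ (inject₁ (even i)) ≡ 2 * stamp i × τ′ (suc (even i)) ≡ 2 * stamp i + 1
    traversal i = traverse-gadget G (gadget i)
      (inject₁≢suc i ∘ vertex-injective) (+0≤⇒≤ (τ′-mono (even i)))
      (subst₂ (λ z z′ → Lab' G z z′ _) before at-gadget (u-label (inject₁ (even i))))
      (subst₂ (λ z z′ → Lab' G z z′ _) at-gadget (u-even (suc i)) (u-label (suc (even i))))
      where
      before : u (inject₁ (inject₁ (even i))) ≡ inj₁ (vertex (inject₁ i))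
      before = trans (cong u (sym (even-inject₁ i))) (u-even (inject₁ i))
      at-gadget : u (suc (inject₁ (even i))) ≡ inj₂ (gadget i)
      at-gadget = trans (cong u (sym (odd≡suc-even i))) (u-odd i)

    τ′-before-odd : ∀ (i : Fin k) → τ′ (inject₁ (odd i)) ≡ 2 * stamp (inject₁ i) + 1
    τ′-before-odd i =
      trans (cong τ′ (inject₁-odd i)) (proj₂ (proj₂ (proj₂ (traversal (inject₁ i)))))

    τ′-after-odd : ∀ (i : Fin k) → τ′ (suc (odd i)) ≡ 2 * stamp (suc i)
    τ′-after-odd i = trans (cong τ′ (suc-odd i)) (proj₁ (proj₂ (proj₂ (traversal (suc i)))))

    labelled : ∀ i → lab G (vertex (inject₁ i)) (vertex (suc i)) (stamp i) ≡ true
    labelled i = subst₂ (λ x y → lab G x y (stamp i) ≡ true)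
      (sym (proj₁ (traversal i))) (sym (proj₁ (proj₂ (traversal i)))) (proj₂ (gadget i))

    path : StrictPath
    path = record
      { m        = k
      ; vert     = vertex
      ; time     = stamp
      ; distinct = λ _ _ → vertex-injective
      ; start    = inj₁-injective (trans (sym (u-even zero)) u-start)
      ; end      = inj₁-injective (trans (sym (u-even (fromℕ (suc k))))
                     (trans (cong u (sym (fromℕ-double (suc k)))) u-end))
      ; edge     = λ i → lab-edge G _ _ _ (labelled i)
      ; label    = labelled
      ; mono     = λ i → 2m+1≤2n⇒m+1≤n (+0≤⇒≤
                     (subst₂ (λ a b → a + 0 ≤ b) (τ′-before-odd i) (τ′-after-odd i) (τ′-mono (odd i))))
      }

    source : NonStrictPath
    source = record
      { m = suc (double k) ; vert = u ; time = τ′ ; distinct = u-distinct ; start = u-start ; end = u-end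
      ; edge = λ b → τ′ b , u-label b ; label = u-label ; mono = τ′-mono }

    reflects : ∀ {x} → Interior path x → Interior source (embed x)
    reflects {v , j} (i , refl , lo , hi) =
        odd i
      , sym (trans (cong (u ∘ suc) (inject₁-odd i)) (u-even (suc (inject₁ i))))
      , subst (λ a → a + 0 ≤ 2 * j) (sym (τ′-before-odd i)) (≤⇒+0≤ (m+1≤n⇒2m+1≤2n lo))
      , subst (2 * j ≤_) (sym (τ′-after-odd i)) (*-monoʳ-≤ 2 hi)

  subdivide : (P : StrictPath) → Σ NonStrictPath λ P′ → ∀ {x} → Interior P′ x → Interior P (project x)
  subdivide P = Subdivide.path P , Subdivide.reflects P

  contract : (P′ : NonStrictPath) → Σ StrictPath λ P → ∀ {x} → Interior P x → Interior P′ (embed x)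
  contract record { m = m ; vert = u ; time = τ′ ; distinct = u-distinct
                  ; start = u-start ; end = u-end ; label = u-label ; mono = τ′-mono }
    with alternating-odd-length u (lab′-crosses G ∘ u-label) (s , u-start) (t , u-end)
  ... | k , refl = C.path , C.reflects
    where module C = Contract k u τ′ u-distinct u-start u-end u-label τ′-mono

lemma8 : (G : TemporalGraph) (s t : Fin (n G)) → adj G s t ≡ false →
    (∀ (k : ℕ) → HasDisjointPaths (toStruct G) 1 s t k
                 ⇔ HasDisjointPaths (expand G) 0 (inj₁ s) (inj₁ t) k)
    × (∀ (h : ℕ) → HasCut (toStruct G) 1 s t h
                   ⇔ HasCut (expand G) 0 (inj₁ s) (inj₁ t) h)
lemma8 G s t s≁t =
    (λ k → mk⇔ Subdivision.disjoint-transfer Contraction.disjoint-transfer)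
  , (λ h → mk⇔ (Contraction.cut-transfer (_≟ᵉ_ G) (expand-within-lifetime G))
               (Subdivision.cut-transfer _≟_ (toStruct-within-lifetime G)))
  where
  open Correspondence G s t s≁t using (project; embed; subdivide; contract)
  module Subdivision = Transfer project subdivide
  module Contraction = Transfer embed contract
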